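{- Let $0\le k\le k+p<n$, let $A=a_1\cdots a_n$ be a binary string with $k\le w(A)\le k+p+1$, let $A^\infty=a_1a_2\cdots$ be generated from $A$ by the symmetric shift register with parameters $k,p,n$, and let $w_i=a_{i+1}+\cdots+a_{i+n}-k$ for $i\ge0$. Let $x=\min\{w_i:0\le i\le 2n\}$ and $y=\max\{w_i:0\le i\le 2n\}$. Then $\min\{w_i:i\ge0\}=x$ and $\max\{w_i:i\ge0\}=y$.
   Context: $w(A)$ is the number of 1's in $A$. The symmetric shift register with parameters $k,p,n$ generates $A^\infty=a_1a_2\cdots$ from $A$ by: for $i\ge0$, $a_{n+i+1}=1-a_{i+1}$ if $k\le a_{i+2}+\cdots+a_{i+n}\le k+p$, and $a_{n+i+1}=a_{i+1}$ otherwise. -}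

module Defs where

open import Data.Nat using (ℕ; zero; suc; _+_; _≤_; _<_; _≤ᵇ_)
open import Data.Bool using (Bool; true; false; not; if_then_else_; _∧_)
open import Data.Vec using (Vec; []; _∷_; head; tail; _∷ʳ_; toList)
open import Data.List using (List; map)
open import Data.Nat.ListAction using (sum)
open import Data.Integer using (ℤ; +_; _-_; _⊓_; _⊔_)
open import Data.Product using (∃; _×_)
open import Relation.Binary.PropositionalEquality using (_≡_)
open import Data.Integer using () renaming (_≤_ to _≤ℤ_)

bit : Bool → ℕ
bit true  = 1
bit false = 0

w : ∀ {n} → Vec Bool n → ℕ
w xs = sum (map bit (toList xs))

-- One step of the symmetric shift register with parameters k,p and length n = suc m:
-- window (a_{i+1}, ..., a_{i+n}) ↦ (a_{i+2}, ..., a_{i+n+1}), where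
-- a_{i+n+1} = 1 - a_{i+1} if k ≤ a_{i+2}+⋯+a_{i+n} ≤ k+p, and a_{i+1} otherwise.
step : (k p : ℕ) {m : ℕ} → Vec Bool (suc m) → Vec Bool (suc m)
step k p (a ∷ rest) =
  rest ∷ʳ (if (k ≤ᵇ w rest) ∧ (w rest ≤ᵇ k + p) then not a else a)

window : (k p : ℕ) {m : ℕ} → Vec Bool (suc m) → ℕ → Vec Bool (suc m)
window k p A zero    = A
window k p A (suc i) = step k p (window k p A i)

-- A^∞ indexed from 0: seqA k p A j = a_{j+1}
seqA : (k p : ℕ) {m : ℕ} → Vec Bool (suc m) → ℕ → Bool
seqA k p A j = head (window k p A j)

wᵢ : (k p : ℕ) {m : ℕ} → Vec Bool (suc m) → ℕ → ℤ
wᵢ k p A i = + w (window k p A i) - + k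

minUpTo : (ℕ → ℤ) → ℕ → ℤ
minUpTo f zero    = f zero
minUpTo f (suc N) = minUpTo f N ⊓ f (suc N)

maxUpTo : (ℕ → ℤ) → ℕ → ℤ
maxUpTo f zero    = f zero
maxUpTo f (suc N) = maxUpTo f N ⊔ f (suc N)

IsMinimum : (ℕ → ℤ) → ℤ → Set
IsMinimum f z = (∃ λ i → f i ≡ z) × (∀ i → z ≤ℤ f i)

IsMaximum : (ℕ → ℤ) → ℤ → Set
IsMaximum f z = (∃ λ i → f i ≡ z) × (∀ i → f i ≤ℤ z)

-- Each step moves the window weight s by at most one and keeps it in [k, k + p + 1]: it
-- rises when a 0 leaves with s ≤ k + p, falls when a 1 leaves with s > k, and otherwise
-- sticks to the floor k or the ceiling k + p + 1. The bit fed back at step t leaves at step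
-- t + n, so the moves at steps j and j + n are linked: if M < k + p + 1 bounds the weights
-- on [0, 2n), then s_j + s_{j+n} ≤ M + s_n persists from j = 0 to j = n, giving s_{2n} ≤ M
-- (dually for lower bounds). Sliding this window along the sequence shows that the
-- extremes on [0, 2n] are global.
module Submission where

open import Defs
open import Data.Nat using (ℕ; zero; suc; _+_; _*_; _≤_; _<_; _≤ᵇ_; _≤?_; z≤n; z<s; s≤s; s≤s⁻¹)
open import Data.Nat.Properties
open import Data.Bool using (Bool; true; false; not; if_then_else_; _∧_)
open import Data.Vec using (Vec; []; _∷_; head; tail; _∷ʳ_)
open import Data.Sum using (_⊎_; inj₁; inj₂)
open import Data.Product using (_×_; _,_; proj₁; proj₂; ∃)
open import Relation.Binary.PropositionalEquality
open import Relation.Nullary using (yes; no; contradiction)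
open import Relation.Nullary.Reflects using (ofʸ; ofⁿ)
open import Data.Integer using (+_; +≤+; _-_; -_) renaming (_≤_ to _≤ℤ_)
import Data.Integer.Properties as ℤ
open import Algebra.Bundles using (AbelianGroup)
open import Algebra.Properties.Group (AbelianGroup.group ℤ.+-0-abelianGroup)
  using (//-rightDividesˡ)

private
  variable
    k p n N : ℕ

rule : (k p r : ℕ) → Bool → Bool
rule k p r b = if (k ≤ᵇ r) ∧ (r ≤ᵇ k + p) then not b else b

step-unfold : (V : Vec Bool (suc n)) → step k p V ≡ tail V ∷ʳ rule k p (w (tail V)) (head V)
step-unfold (x ∷ xs) = refl

w-head-tail : (V : Vec Bool (suc n)) → w V ≡ bit (head V) + w (tail V)
w-head-tail (x ∷ xs) = refl

w-∷ʳ : (xs : Vec Bool n) (b : Bool) → w (xs ∷ʳ b) ≡ w xs + bit b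
w-∷ʳ []       b = +-identityʳ (bit b)
w-∷ʳ (x ∷ xs) b = trans (cong (_+_ (bit x)) (w-∷ʳ xs b)) (sym (+-assoc (bit x) (w xs) (bit b)))

w-step : (V : Vec Bool (suc n)) → w (step k p V) ≡ w (tail V) + bit (rule k p (w (tail V)) (head V))
w-step (x ∷ xs) = w-∷ʳ xs _

lookupℕ : Vec Bool n → ℕ → Bool
lookupℕ []       _       = false
lookupℕ (x ∷ xs) zero    = x
lookupℕ (x ∷ xs) (suc i) = lookupℕ xs i

lookupℕ-∷ʳ-< : (xs : Vec Bool n) (b : Bool) {i : ℕ} → i < n → lookupℕ (xs ∷ʳ b) i ≡ lookupℕ xs i
lookupℕ-∷ʳ-< (x ∷ xs) b {zero}  _   = refl
lookupℕ-∷ʳ-< (x ∷ xs) b {suc i} i<n = lookupℕ-∷ʳ-< xs b (s≤s⁻¹ i<n)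

lookupℕ-∷ʳ-length : (xs : Vec Bool n) (b : Bool) → lookupℕ (xs ∷ʳ b) n ≡ b
lookupℕ-∷ʳ-length []       b = refl
lookupℕ-∷ʳ-length (x ∷ xs) b = lookupℕ-∷ʳ-length xs b

lookupℕ-step : (V : Vec Bool (suc n)) {i : ℕ} → i < n → lookupℕ (step k p V) i ≡ lookupℕ V (suc i)
lookupℕ-step (x ∷ xs) = lookupℕ-∷ʳ-< xs _

module _ (k p : ℕ) {m : ℕ} (A : Vec Bool (suc m)) where

  lookupℕ-window : ∀ t j i → i + j ≤ m →
                   lookupℕ (window k p A (j + t)) i ≡ lookupℕ (window k p A t) (i + j)
  lookupℕ-window t zero    i _   = cong (lookupℕ (window k p A t)) (sym (+-identityʳ i))
  lookupℕ-window t (suc j) i i+1+j≤m = begin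
    lookupℕ (step k p (window k p A (j + t))) i  ≡⟨ lookupℕ-step (window k p A (j + t)) i<m ⟩
    lookupℕ (window k p A (j + t)) (suc i)       ≡⟨ lookupℕ-window t j (suc i) 1+i+j≤m ⟩
    lookupℕ (window k p A t) (suc i + j)         ≡⟨ cong (lookupℕ (window k p A t)) (sym (+-suc i j)) ⟩
    lookupℕ (window k p A t) (i + suc j)         ∎
    where
      open ≡-Reasoning
      1+i+j≤m : suc i + j ≤ m
      1+i+j≤m = subst (_≤ m) (+-suc i j) i+1+j≤m
      i<m : i < m
      i<m = ≤-trans (s≤s (m≤m+n i j)) 1+i+j≤m

  -- The bit fed back at step t ends window t + 1, so m steps later it heads the window.
  head-window-feedback : ∀ t → head (window k p A (t + suc m)) ≡
                         rule k p (w (tail (window k p A t))) (head (window k p A t))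
  head-window-feedback t = begin
    head (window k p A (t + suc m))           ≡⟨ cong (λ i → head (window k p A i)) t+1+m≡m+1+t ⟩
    head (window k p A (m + suc t))           ≡⟨ head-lookupℕ (window k p A (m + suc t)) ⟩
    lookupℕ (window k p A (m + suc t)) 0      ≡⟨ lookupℕ-window (suc t) m 0 ≤-refl ⟩
    lookupℕ (window k p A (suc t)) m          ≡⟨ cong (λ V → lookupℕ V m) (step-unfold (window k p A t)) ⟩
    lookupℕ (tail (window k p A t) ∷ʳ _) m     ≡⟨ lookupℕ-∷ʳ-length (tail (window k p A t)) _ ⟩
    rule k p (w (tail (window k p A t))) (head (window k p A t)) ∎
    where
      open ≡-Reasoning
      t+1+m≡m+1+t : t + suc m ≡ m + suc t
      t+1+m≡m+1+t = trans (+-comm t (suc m)) (sym (+-suc m t))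
      head-lookupℕ : (V : Vec Bool (suc m)) → head V ≡ lookupℕ V 0
      head-lookupℕ (x ∷ xs) = refl

-- The weight dynamics, abstracted from the vectors: a t = a_{t+1} is the bit leaving the
-- window at step t, weight t = w_t + k, and tailWeight t is the weight without that bit.
record Register (k p N : ℕ) : Set where
  field
    a           : ℕ → Bool
    weight      : ℕ → ℕ
    tailWeight  : ℕ → ℕ
    weight-head : ∀ t → weight t ≡ bit (a t) + tailWeight t
    weight-suc  : ∀ t → weight (suc t) ≡ tailWeight t + bit (a (t + N))
    feedback    : ∀ t → a (t + N) ≡ rule k p (tailWeight t) (a t)

shiftRegister : (k p m : ℕ) → Vec Bool (suc m) → Register k p (suc m)
shiftRegister k p m A = record
  { a           = seqA k p A
  ; weight      = λ t → w (window k p A t)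
  ; tailWeight  = λ t → w (tail (window k p A t))
  ; weight-head = λ t → w-head-tail (window k p A t)
  ; weight-suc  = λ t → trans (w-step (window k p A t))
                        (cong (λ b → w (tail (window k p A t)) + bit b)
                              (sym (head-window-feedback k p A t)))
  ; feedback    = head-window-feedback k p A
  }

shift : ℕ → Register k p N → Register k p N
shift {N = N} t R = record
  { a           = λ i → a (t + i)
  ; weight      = λ i → weight (t + i)
  ; tailWeight  = λ i → tailWeight (t + i)
  ; weight-head = λ i → weight-head (t + i)
  ; weight-suc  = λ i → trans (cong weight (+-suc t i))
                        (trans (weight-suc (t + i))
                               (cong (λ j → tailWeight (t + i) + bit (a j)) (+-assoc t i N)))
  ; feedback    = λ i → trans (cong a (sym (+-assoc t i N))) (feedback (t + i))
  }
  where open Register R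

InRange : (k p x : ℕ) → Set
InRange k p x = k ≤ x × x ≤ suc (k + p)

data Move (k p : ℕ) : Bool → Bool → ℕ → ℕ → Set where
  rise    : ∀ {s} → k ≤ s → s ≤ k + p → Move k p false true s (suc s)
  fall    : ∀ {s} → k ≤ s → s ≤ k + p → Move k p true false (suc s) s
  floor   : Move k p true true k k
  ceiling : Move k p false false (suc (k + p)) (suc (k + p))

move : ∀ b r → InRange k p (bit b + r) →
       Move k p b (rule k p r b) (bit b + r) (r + bit (rule k p r b))
move {k} {p} b r (lo , hi)
  with k ≤ᵇ r | ≤ᵇ-reflects-≤ k r | r ≤ᵇ k + p | ≤ᵇ-reflects-≤ r (k + p)
move false r (lo , hi) | true | ofʸ k≤r | true | ofʸ r≤k+p =
  subst (Move _ _ false true r) (+-comm 1 r) (rise k≤r r≤k+p)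
move false r (lo , hi) | true | ofʸ _ | false | ofⁿ r≰k+p
  rewrite +-identityʳ r | ≤-antisym hi (≰⇒> r≰k+p) = ceiling
move false r (lo , hi) | false | ofⁿ k≰r | _ | _ = contradiction lo k≰r
move true r (lo , hi) | true | ofʸ k≤r | true | ofʸ r≤k+p
  rewrite +-identityʳ r = fall k≤r r≤k+p
move true r (lo , hi) | true | ofʸ _ | false | ofⁿ r≰k+p = contradiction (s≤s⁻¹ hi) r≰k+p
move true r (lo , hi) | false | ofⁿ k≰r | _ | _
  rewrite +-comm r 1 | ≤-antisym lo (≰⇒> k≰r) = floor

move-inRange : ∀ {b b′ s s′} → Move k p b b′ s s′ → InRange k p s′
move-inRange (rise k≤s s≤k+p) = m≤n⇒m≤1+n k≤s , s≤s s≤k+p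
move-inRange (fall k≤s s≤k+p) = k≤s , m≤n⇒m≤1+n s≤k+p
move-inRange {k} {p} floor    = ≤-refl , m≤n⇒m≤1+n (m≤m+n k p)
move-inRange {k} {p} ceiling  = m≤n⇒m≤1+n (m≤m+n k p) , ≤-refl

-- Two steps N apart share a bit: the one fed back by the first leaves at the second.
moves-max : ∀ {x y z s₁ s₁′ s₂ s₂′} → s₁ < suc (k + p) →
            Move k p x y s₁ s₁′ → Move k p y z s₂ s₂′ → s₁′ + s₂′ ≤ s₁ + s₂ ⊎ s₂′ ≡ k
moves-max _ (rise {s₁} _ _) (fall {s₂′} _ _) = inj₁ (≤-reflexive (sym (+-suc s₁ s₂′)))
moves-max _ (rise _ _)      floor            = inj₂ refl
moves-max _ (fall {s₁′} _ _) (rise {s₂} _ _) = inj₁ (≤-reflexive (+-suc s₁′ s₂))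
moves-max _ (fall _ _)      ceiling          = inj₁ (n≤1+n _)
moves-max {k} _ floor       (fall _ _)       = inj₁ (+-monoʳ-≤ k (n≤1+n _))
moves-max _ floor           floor            = inj₁ ≤-refl
moves-max {k} {p} T<T ceiling _              = contradiction T<T (n≮n (suc (k + p)))

moves-min : ∀ {x y z s₁ s₁′ s₂ s₂′} → k < s₁ →
            Move k p x y s₁ s₁′ → Move k p y z s₂ s₂′ → s₁ + s₂ ≤ s₁′ + s₂′ ⊎ s₂′ ≡ suc (k + p)
moves-min _ (rise {s₁} _ _) (fall {s₂′} _ _) = inj₁ (≤-reflexive (+-suc s₁ s₂′))
moves-min _ (rise _ _)      floor            = inj₁ (n≤1+n _)
moves-min _ (fall {s₁′} _ _) (rise {s₂} _ _) = inj₁ (≤-reflexive (sym (+-suc s₁′ s₂)))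
moves-min _ (fall _ _)      ceiling          = inj₂ refl
moves-min {k} k<k floor _                    = contradiction k<k (n≮n k)
moves-min {k} {p} _ ceiling (rise _ _)       = inj₁ (+-monoʳ-≤ (suc (k + p)) (n≤1+n _))
moves-min _ ceiling         ceiling          = inj₁ ≤-refl

2*n≡n+n : ∀ n → 2 * n ≡ n + n
2*n≡n+n n = cong (_+_ n) (+-identityʳ n)

module _ (R : Register k p N) where
  open Register R

  moveAt : ∀ t → InRange k p (weight t) → Move k p (a t) (a (t + N)) (weight t) (weight (suc t))
  moveAt t inRange rewrite weight-suc t | feedback t | weight-head t =
    move (a t) (tailWeight t) inRange

  weight-inRange : InRange k p (weight 0) → ∀ t → InRange k p (weight t)
  weight-inRange inRange₀ zero    = inRange₀
  weight-inRange inRange₀ (suc t) = move-inRange (moveAt t (weight-inRange inRange₀ t))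

  module _ (N>0 : 0 < N) (inRange : ∀ t → InRange k p (weight t)) where

    private
      <N+N : ∀ {j} → j ≤ N → j < N + N
      <N+N j≤N = ≤-<-trans j≤N (m<m+n N N>0)

      moves : ∀ t → Move k p (a t) (a (t + N)) (weight t) (weight (suc t))
      moves t = moveAt t (inRange t)

    weight-max-block : ∀ M → (∀ i → i < 2 * N → weight i ≤ M) → weight (2 * N) ≤ M
    weight-max-block M bounded rewrite 2*n≡n+n N with suc (k + p) ≤? M
    ... | yes T≤M = ≤-trans (proj₂ (inRange (N + N))) T≤M
    ... | no T≰M  = +-cancelˡ-≤ (weight N) _ _
                      (subst (weight N + weight (N + N) ≤_) (+-comm M (weight N)) (pairs N ≤-refl))
      where
        pairs : ∀ j → j ≤ N → weight j + weight (j + N) ≤ M + weight N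
        pairs zero    _     = +-monoˡ-≤ (weight N) (bounded 0 (<N+N z≤n))
        pairs (suc j) j<N
          with moves-max (≤-<-trans (bounded j (<N+N (<⇒≤ j<N))) (≰⇒> T≰M))
                         (moves j) (moves (j + N))
        ... | inj₁ le      = ≤-trans le (pairs j (<⇒≤ j<N))
        ... | inj₂ atFloor =
          subst (λ x → weight (suc j) + x ≤ M + weight N) (sym atFloor)
                (+-mono-≤ (bounded (suc j) (<N+N j<N)) (proj₁ (inRange N)))

    weight-min-block : ∀ M → (∀ i → i < 2 * N → M ≤ weight i) → M ≤ weight (2 * N)
    weight-min-block M bounded rewrite 2*n≡n+n N with M ≤? k
    ... | yes M≤k = ≤-trans M≤k (proj₁ (inRange (N + N)))
    ... | no M≰k  = +-cancelˡ-≤ (weight N) _ _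
                      (subst (_≤ weight N + weight (N + N)) (+-comm M (weight N)) (pairs N ≤-refl))
      where
        pairs : ∀ j → j ≤ N → M + weight N ≤ weight j + weight (j + N)
        pairs zero    _     = +-monoˡ-≤ (weight N) (bounded 0 (<N+N z≤n))
        pairs (suc j) j<N
          with moves-min (<-≤-trans (≰⇒> M≰k) (bounded j (<N+N (<⇒≤ j<N))))
                         (moves j) (moves (j + N))
        ... | inj₁ le        = ≤-trans (pairs j (<⇒≤ j<N)) le
        ... | inj₂ atCeiling =
          subst (λ x → M + weight N ≤ weight (suc j) + x) (sym atCeiling)
                (+-mono-≤ (bounded (suc j) (<N+N j<N)) (proj₂ (inRange N)))

sliding-induction : ∀ {P : ℕ → Set} L → (∀ i → i ≤ L → P i) →
                    (∀ t → (∀ i → i < L → P (t + i)) → P (t + L)) → ∀ t → P t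
sliding-induction {P} L initial next t = subst P (+-identityʳ t) (from t z≤n)
  where
    from : ∀ t {i} → i ≤ L → P (t + i)
    from zero    i≤L = initial _ i≤L
    from (suc t) {i} i≤L with m≤n⇒m<n∨m≡n i≤L
    ... | inj₁ i<L  = subst P (+-suc t i) (from t i<L)
    ... | inj₂ refl = next (suc t) λ j j<L → subst P (+-suc t j) (from t j<L)

f≤maxUpTo : ∀ f L {i} → i ≤ L → f i ≤ℤ maxUpTo f L
f≤maxUpTo f zero    z≤n = ℤ.≤-refl
f≤maxUpTo f (suc L) i≤L with m≤n⇒m<n∨m≡n i≤L
... | inj₁ i<L  = ℤ.i≤j⇒i≤j⊔k (f (suc L)) (f≤maxUpTo f L (s≤s⁻¹ i<L))
... | inj₂ refl = ℤ.i≤j⊔i (maxUpTo f L) (f (suc L))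

minUpTo≤f : ∀ f L {i} → i ≤ L → minUpTo f L ≤ℤ f i
minUpTo≤f f zero    z≤n = ℤ.≤-refl
minUpTo≤f f (suc L) i≤L with m≤n⇒m<n∨m≡n i≤L
... | inj₁ i<L  = ℤ.i≤j⇒i⊓k≤j (f (suc L)) (minUpTo≤f f L (s≤s⁻¹ i<L))
... | inj₂ refl = ℤ.i⊓j≤j (minUpTo f L) (f (suc L))

maxUpTo-attained : ∀ f L → ∃ λ i → f i ≡ maxUpTo f L
maxUpTo-attained f zero    = 0 , refl
maxUpTo-attained f (suc L) with ℤ.⊔-sel (maxUpTo f L) (f (suc L))
... | inj₁ eq = let i , fi≡max = maxUpTo-attained f L in i , trans fi≡max (sym eq)
... | inj₂ eq = suc L , sym eq

minUpTo-attained : ∀ f L → ∃ λ i → f i ≡ minUpTo f L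
minUpTo-attained f zero    = 0 , refl
minUpTo-attained f (suc L) with ℤ.⊓-sel (minUpTo f L) (f (suc L))
... | inj₁ eq = let i , fi≡min = minUpTo-attained f L in i , trans fi≡min (sym eq)
... | inj₂ eq = suc L , sym eq

maxUpTo-isMaximum : ∀ f L → (∀ j t → (∀ i → i < L → f (t + i) ≤ℤ f j) → f (t + L) ≤ℤ f j) →
                    IsMaximum f (maxUpTo f L)
maxUpTo-isMaximum f L next with maxUpTo-attained f L
... | j , fj≡max = (j , fj≡max) , λ i → subst (f i ≤ℤ_) fj≡max
  (sliding-induction L (λ i i≤L → subst (f i ≤ℤ_) (sym fj≡max) (f≤maxUpTo f L i≤L)) (next j) i)

minUpTo-isMinimum : ∀ f L → (∀ j t → (∀ i → i < L → f j ≤ℤ f (t + i)) → f j ≤ℤ f (t + L)) →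
                    IsMinimum f (minUpTo f L)
minUpTo-isMinimum f L next with minUpTo-attained f L
... | j , fj≡min = (j , fj≡min) , λ i → subst (_≤ℤ f i) fj≡min
  (sliding-induction L (λ i i≤L → subst (_≤ℤ f i) (sym fj≡min) (minUpTo≤f f L i≤L)) (next j) i)

i≤j⇒i-k≤j-k : ∀ {i j} k → i ≤ℤ j → i - k ≤ℤ j - k
i≤j⇒i-k≤j-k k = ℤ.+-monoˡ-≤ (- k)

i-k≤j-k⇒i≤j : ∀ {i j} k → i - k ≤ℤ j - k → i ≤ℤ j
i-k≤j-k⇒i≤j {i} {j} k le =
  subst₂ _≤ℤ_ (//-rightDividesˡ k i) (//-rightDividesˡ k j) (ℤ.+-monoˡ-≤ k le)

module _ (k p m : ℕ) (A : Vec Bool (suc m)) (inRange₀ : InRange k p (w A)) where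
  private
    R = shiftRegister k p m A
    open Register R using (weight)

    inRange : ∀ t → InRange k p (weight t)
    inRange = weight-inRange R inRange₀

  wᵢ-max-step : ∀ j t → (∀ i → i < 2 * suc m → wᵢ k p A (t + i) ≤ℤ wᵢ k p A j) →
                wᵢ k p A (t + 2 * suc m) ≤ℤ wᵢ k p A j
  wᵢ-max-step j t bounded = i≤j⇒i-k≤j-k (+ k) (+≤+
    (weight-max-block (shift t R) z<s (λ i → inRange (t + i)) (weight j) λ i i<2N →
      ℤ.drop‿+≤+ (i-k≤j-k⇒i≤j (+ k) (bounded i i<2N))))

  wᵢ-min-step : ∀ j t → (∀ i → i < 2 * suc m → wᵢ k p A j ≤ℤ wᵢ k p A (t + i)) →
                wᵢ k p A j ≤ℤ wᵢ k p A (t + 2 * suc m)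
  wᵢ-min-step j t bounded = i≤j⇒i-k≤j-k (+ k) (+≤+
    (weight-min-block (shift t R) z<s (λ i → inRange (t + i)) (weight j) λ i i<2N →
      ℤ.drop‿+≤+ (i-k≤j-k⇒i≤j (+ k) (bounded i i<2N))))

proposition78p1 : (k p m : ℕ) → k + p < suc m → (A : Vec Bool (suc m)) →
    k ≤ w A → w A ≤ k + p + 1 →
    IsMinimum (wᵢ k p A) (minUpTo (wᵢ k p A) (2 * suc m)) ×
    IsMaximum (wᵢ k p A) (maxUpTo (wᵢ k p A) (2 * suc m))
proposition78p1 k p m _ A k≤wA wA≤k+p+1 =
  minUpTo-isMinimum (wᵢ k p A) (2 * suc m) (wᵢ-min-step k p m A inRange₀) ,
  maxUpTo-isMaximum (wᵢ k p A) (2 * suc m) (wᵢ-max-step k p m A inRange₀)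
  where
    inRange₀ : InRange k p (w A)
    inRange₀ = k≤wA , subst (w A ≤_) (+-comm (k + p) 1) wA≤k+p+1
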